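{- Let $G=(V,E)$ be an undirected, connected, simple graph with $n=|V|$ vertices, adjacency matrix $A$, degrees $d_u$, Laplacian $L=D-A$, and let $b(s,t)=(\mathbf e_s-\mathbf e_t)^{\top}(L^{\dagger})^2(\mathbf e_s-\mathbf e_t)$ with $L^\dagger$ the Moore–Penrose pseudoinverse. For $S\subsetneq V$ let $L_S$ be the principal submatrix of $L$ indexed by $S$. Let $v,c_1,\dots,c_j\in V$ be distinct vertices, set $R^{(0)}=V\setminus\{v\}$ and $R^{(i)}=R^{(i-1)}\setminus\{c_i\}$ for $i=1,\dots,j$, and suppose $R^{(j)}=\mathcal V_s\sqcup\mathcal V_t$ where no edge of $G$ joins $\mathcal V_s$ and $\mathcal V_t$, with $s\in\mathcal V_s$ and $t\in\mathcal V_t$. For $i=1,\dots,j$, order $R^{(i-1)}$ with $c_i$ last, so that $L_{R^{(i-1)}}=\begin{bmatrix}L_{R^{(i)}}&-\boldsymbol a_{c_i}\\-\boldsymbol a_{c_i}^{\top}&d_{c_i}\end{bmatrix}$ with $\boldsymbol a_{c_i}\in\mathbb R^{R^{(i)}}$, $\boldsymbol a_{c_i}[u]=A_{c_i u}$; let $S_{c_i}=d_{c_i}-\boldsymbol a_{c_i}^{\top}L_{R^{(i)}}^{ -1}\boldsymbol a_{c_i}$ and $$\mathbf M^{(i)}_{c_i}=\begin{bmatrix}L_{R^{(i)}}^{ -1}\boldsymbol a_{c_i}\\1\end{bmatrix}S_{c_i}^{ -1}\begin{bmatrix}\boldsymbol a_{c_i}^{\top}L_{R^{(i)}}^{ -1}&1\end{bmatrix}\in\mathbb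 R^{R^{(i-1)}\times R^{(i-1)}},$$ and let $\widetilde{\mathbf M}_{c_i}\in\mathbb R^{V\times V}$ be $\mathbf M^{(i)}_{c_i}$ padded with zeros. Then, with $\mathbf 1\in\mathbb R^V$ the all-ones vector and $\mathbf y=\tilde{\boldsymbol\tau}^{(\mathcal V_s)}_s-\tilde{\boldsymbol\tau}^{(\mathcal V_t)}_t+\sum_{i=1}^{j}\widetilde{\mathbf M}_{c_i}(\mathbf e_s-\mathbf e_t)$, $$b(s,t)=\|\mathbf y\|_2^2-\frac1n\big(\mathbf 1^{\top}\mathbf y\big)^2 .$$
   Context: The simple random walk on $G$ moves from its current vertex to a uniformly random neighbor. For $s\in\mathcal V_s$, $\tilde{\boldsymbol\tau}^{(\mathcal V_s)}_s\in\mathbb R^V$ has entry at $u\in\mathcal V_s$ equal to $\frac1{d_u}$ times the expected number of times $k\ge0$ that the walk $X_0=s,X_1,\dots$ is at $u$ before it first leaves $\mathcal V_s$ (i.e. first hits $\{v,c_1,\dots,c_j\}$), and entry $0$ outside $\mathcal V_s$; equivalently it is $L_{\mathcal V_s}^{ -1}\mathbf e_s$ extended by zeros. $\tilde{\boldsymbol\tau}^{(\mathcal V_t)}_t$ is defined analogously. -}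

module Defs where

open import Data.Nat using (ℕ; zero; suc; _<ᵇ_)
open import Data.Fin using (Fin; zero; suc; toℕ; _≟_)
open import Data.Bool using (Bool; true; false; _∧_; _∨_; not; if_then_else_)
open import Data.Rational using (ℚ; 0ℚ; 1ℚ; _+_; _*_; _-_; -_; _/_)
open import Data.Integer using (+_)
open import Data.Product using (_×_)
open import Relation.Nullary using (¬_)
open import Relation.Nullary.Decidable using (⌊_⌋)
open import Relation.Binary.PropositionalEquality using (_≡_)

Vect : ℕ → Set
Vect n = Fin n → ℚ

Mat : ℕ → Set
Mat n = Fin n → Fin n → ℚ

sumF : ∀ {n} → (Fin n → ℚ) → ℚ
sumF {zero}  f = 0ℚ
sumF {suc n} f = f zero + sumF (λ i → f (suc i))

b2q : Bool → ℚ
b2q true  = 1ℚ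
b2q false = 0ℚ

_==_ : ∀ {n} → Fin n → Fin n → Bool
u == w = ⌊ u ≟ w ⌋

e : ∀ {n} → Fin n → Vect n
e s u = b2q (u == s)

ones : ∀ {n} → Vect n
ones _ = 1ℚ

_⊕_ : ∀ {n} → Vect n → Vect n → Vect n
(x ⊕ y) u = x u + y u

_⊖_ : ∀ {n} → Vect n → Vect n → Vect n
(x ⊖ y) u = x u - y u

_·_ : ∀ {n} → Vect n → Vect n → ℚ
x · y = sumF (λ u → x u * y u)

_⋆_ : ∀ {n} → Mat n → Vect n → Vect n
(M ⋆ x) u = sumF (λ k → M u k * x k)

_⊗_ : ∀ {n} → Mat n → Mat n → Mat n
(M ⊗ N) u w = sumF (λ k → M u k * N k w)

transpose : ∀ {n} → Mat n → Mat n
transpose M u w = M w u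

sumFin : ∀ {j} {n} → (Fin j → Vect n) → Vect n
sumFin {zero}  f u = 0ℚ
sumFin {suc j} f u = f zero u + sumFin (λ i → f (suc i)) u

record SimpleGraph (n : ℕ) : Set where
  field
    adj   : Fin n → Fin n → Bool
    sym   : ∀ u w → adj u w ≡ adj w u
    irrefl : ∀ u → adj u u ≡ false
open SimpleGraph public

data Reach {n} (G : SimpleGraph n) : Fin n → Fin n → Set where
  here : ∀ {u} → Reach G u u
  step : ∀ {u w x} → adj G u w ≡ true → Reach G w x → Reach G u x

Connected : ∀ {n} → SimpleGraph n → Set
Connected G = ∀ u w → Reach G u w

Amat : ∀ {n} → SimpleGraph n → Mat n
Amat G u w = b2q (adj G u w)

deg : ∀ {n} → SimpleGraph n → Fin n → ℚ
deg G u = sumF (λ w → Amat G u w)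

Lap : ∀ {n} → SimpleGraph n → Mat n
Lap G u w = if u == w then deg G u else - Amat G u w

IsPseudoInverse : ∀ {n} → Mat n → Mat n → Set
IsPseudoInverse L P =
  ((L ⊗ P) ⊗ L ≡ L) × ((P ⊗ L) ⊗ P ≡ P) ×
  (transpose (L ⊗ P) ≡ L ⊗ P) × (transpose (P ⊗ L) ≡ P ⊗ L)

bST : ∀ {n} → Mat n → Fin n → Fin n → ℚ
bST P s t = (e s ⊖ e t) · ((P ⊗ P) ⋆ (e s ⊖ e t))

Subset : ℕ → Set
Subset n = Fin n → Bool

-- X ∈ ℝ^{V×V} is L_S^{-1} padded with zeros:
-- X vanishes outside S×S and L_S (X restricted to S×S) = I_S.
IsPaddedInverse : ∀ {n} → Mat n → Subset n → Mat n → Set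
IsPaddedInverse {n} L S X =
  (∀ u w → S u ≡ false → X u w ≡ 0ℚ) ×
  (∀ u w → S w ≡ false → X u w ≡ 0ℚ) ×
  (∀ u w → S u ≡ true → S w ≡ true →
     sumF (λ k → b2q (S k) * (L u k * X k w)) ≡ b2q (u == w))

-- R^{(i)} = V ∖ {v, c_1, …, c_i}, where c : Fin j → Fin n lists c_1,…,c_j
-- (c_{k+1} = c k) and i ranges over 0..j.
allF : ∀ {j} → (Fin j → Bool) → Bool
allF {zero}  f = true
allF {suc j} f = f zero ∧ allF (λ k → f (suc k))

R : ∀ {n j} → Fin n → (Fin j → Fin n) → ℕ → Subset n
R v c i u = not (u == v) ∧ allF (λ k → not ((toℕ k <ᵇ i) ∧ (u == c k)))

-- 1/n (n ≥ 1 in the theorem since v ∈ V)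
invℕ : ℕ → ℚ
invℕ zero    = 0ℚ
invℕ (suc m) = (+ 1) / suc m

-- The Schur-complement correction terms, for i = k+1 (k : Fin j).
-- Y = padded L_{R^{(i)}}^{-1}, c = c_i.

aVec : ∀ {n} → SimpleGraph n → Subset n → Fin n → Vect n
aVec G S c u = b2q (S u) * Amat G c u

schur : ∀ {n} → SimpleGraph n → Subset n → Mat n → Fin n → ℚ
schur G S Y c = deg G c - (aVec G S c · (Y ⋆ aVec G S c))

-- the vector [L_{R^{(i)}}^{-1} a ; 1] ∈ ℝ^{R^{(i-1)}}, padded to ℝ^V
wVec : ∀ {n} → SimpleGraph n → Subset n → Mat n → Fin n → Vect n
wVec G S Y c = (Y ⋆ aVec G S c) ⊕ e c

-- M̃_{c_i} = w σ wᵀ padded, where σ = S_{c_i}^{-1}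
Mtilde : ∀ {n} → SimpleGraph n → Subset n → Mat n → Fin n → ℚ → Mat n
Mtilde G S Y c σ u w = wVec G S Y c u * (σ * wVec G S Y c w)

{-# OPTIONS --safe #-}

-- Let x = e_s − e_t. On R⁽ʲ⁾ = V_s ⊔ V_t the difference of the two τ̃ vectors solves L_{R⁽ʲ⁾} y = x,
-- because no edge joins V_s and V_t. Adding M̃_{cᵢ} x turns a solution on R⁽ⁱ⁾ into one on
-- R⁽ⁱ⁻¹⁾ = R⁽ⁱ⁾ ∪ {cᵢ}: block inversion of L_{R⁽ⁱ⁻¹⁾} through the Schur complement S_{cᵢ}. Hence L y = x
-- off v, and at v too since the columns of L and the entries of x both sum to zero. As G is connected,
-- ker L consists of the constants, so the Penrose equations give L† x = L†ᵀ x = y − (𝟙ᵀy / n) 𝟙, and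
-- b(s,t) = (L†ᵀ x)ᵀ (L† x) = ‖y‖² − (𝟙ᵀy)² / n.
module Submission where

open import Defs renaming (sym to adj-sym; irrefl to adj-irrefl)
open import Algebra.Bundles using (CommutativeRing)
open import Data.Bool using (Bool; true; false; _∧_; _∨_; not)
open import Data.Bool.Properties
  using (not-injective; ∧-conicalˡ; ∧-conicalʳ; ∧-zeroʳ; ∧-identityʳ; ∨-conicalˡ; ∨-conicalʳ; ∨-identityʳ; ⇔→≡; T-≡)
open import Data.Fin using (Fin; zero; suc; toℕ; _≟_)
open import Data.Fin.Properties using (suc-injective; toℕ-injective)
open import Data.Integer as ℤ using (ℤ; 1ℤ)
open import Data.Integer.Tactic.RingSolver renaming (solve-∀ to ℤ-solve-∀)
open import Data.Nat as ℕ using (ℕ; zero; suc)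
import Data.Nat.Coprimality as Cop
open import Data.Nat.Properties using (<ᵇ⇒<; <⇒<ᵇ; m<n⇒m<1+n; n<1+n; m<1+n⇒m<n∨m≡n; <-irrefl)
open import Data.Product using (Σ; _×_; _,_; proj₁; proj₂)
open import Data.Rational using (ℚ; mkℚ; 0ℚ; 1ℚ; _*_; _-_; _+_; -_; _≤_)
import Data.Rational.Properties as ℚ
import Data.Rational.Unnormalised.Base as ℚᵘ
import Data.Rational.Unnormalised.Properties as ℚᵘ
open import Data.Sum using (inj₁; inj₂)
open import Function using (_∘_; _⇔_; mk⇔; Equivalence)
open import Function.Definitions using (Injective)
open import Relation.Binary.PropositionalEquality
  using (_≡_; _≢_; _≗_; refl; sym; trans; cong; cong₂; subst; module ≡-Reasoning)
open import Relation.Nullary using (¬_; Dec; yes; no)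
open import Relation.Nullary.Decidable using (dec-true; dec-false; isYes≗does)
open import Relation.Nullary.Decidable.Core using (dec⇒maybe)
open import Tactic.RingSolver using (solve-∀)
open import Tactic.RingSolver.Core.AlmostCommutativeRing using (AlmostCommutativeRing; fromCommutativeRing)

open import Algebra.Properties.Group ℚ.+-0-group using (x∙y⁻¹≈ε⇒x≈y)
open import Algebra.Properties.Semiring.Sum (CommutativeRing.semiring ℚ.+-*-commutativeRing)
  using (sum; sum-cong-≗; ∑-distrib-+; ∑-comm; *-distribˡ-sum; *-distribʳ-sum; sum-replicate-zero)

open ≡-Reasoning

-- Sums, vectors and matrices

ℚ-ring : AlmostCommutativeRing _ _
ℚ-ring = fromCommutativeRing ℚ.+-*-commutativeRing (λ x → dec⇒maybe (0ℚ ℚ.≟ x))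

sumF≡sum : ∀ {n} (f : Fin n → ℚ) → sumF f ≡ sum f
sumF≡sum {zero}  f = refl
sumF≡sum {suc n} f = cong (f zero +_) (sumF≡sum (f ∘ suc))

sumF-cong : ∀ {n} {f g : Fin n → ℚ} → f ≗ g → sumF f ≡ sumF g
sumF-cong {f = f} {g} f≗g = trans (sumF≡sum f) (trans (sum-cong-≗ f≗g) (sym (sumF≡sum g)))

sumF-distrib-+ : ∀ {n} (f g : Fin n → ℚ) → sumF (λ u → f u + g u) ≡ sumF f + sumF g
sumF-distrib-+ f g = trans (sumF≡sum (λ u → f u + g u))
  (trans (∑-distrib-+ f g) (sym (cong₂ _+_ (sumF≡sum f) (sumF≡sum g))))

*-distribˡ-sumF : ∀ {n} a (f : Fin n → ℚ) → a * sumF f ≡ sumF (λ u → a * f u)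
*-distribˡ-sumF a f = trans (cong (a *_) (sumF≡sum f)) (trans (*-distribˡ-sum a f) (sym (sumF≡sum (λ u → a * f u))))

*-distribʳ-sumF : ∀ {n} a (f : Fin n → ℚ) → sumF f * a ≡ sumF (λ u → f u * a)
*-distribʳ-sumF a f = trans (cong (_* a) (sumF≡sum f)) (trans (*-distribʳ-sum a f) (sym (sumF≡sum (λ u → f u * a))))

sumF-zero : ∀ {n} {f : Fin n → ℚ} → (∀ u → f u ≡ 0ℚ) → sumF f ≡ 0ℚ
sumF-zero {n} f≗0 = trans (sumF-cong f≗0) (trans (sumF≡sum {n} (λ _ → 0ℚ)) (sum-replicate-zero n))

sumF-comm : ∀ {m n} (f : Fin m → Fin n → ℚ) →
  sumF (λ u → sumF (f u)) ≡ sumF (λ k → sumF (λ u → f u k))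
sumF-comm f = trans (sumF²≡sum² f) (trans (∑-comm f) (sym (sumF²≡sum² (λ k u → f u k))))
  where
  sumF²≡sum² : ∀ {m n} (g : Fin m → Fin n → ℚ) → sumF (λ u → sumF (g u)) ≡ sum (λ u → sum (g u))
  sumF²≡sum² g = trans (sumF-cong (sumF≡sum ∘ g)) (sumF≡sum (λ u → sum (g u)))

sumF-neg : ∀ {n} (f : Fin n → ℚ) → sumF (λ u → - f u) ≡ - sumF f
sumF-neg {zero}  f = refl
sumF-neg {suc n} f = trans (cong (- f zero +_) (sumF-neg (f ∘ suc))) (sym (ℚ.neg-distrib-+ (f zero) (sumF (f ∘ suc))))

sumF-distrib-- : ∀ {n} (f g : Fin n → ℚ) → sumF (λ u → f u - g u) ≡ sumF f - sumF g
sumF-distrib-- f g = trans (sumF-distrib-+ f (λ u → - g u)) (cong (sumF f +_) (sumF-neg g))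

sumF-single : ∀ {n} (v : Fin n) (f : Fin n → ℚ) → (∀ u → u ≢ v → f u ≡ 0ℚ) → sumF f ≡ f v
sumF-single zero    f off = trans (cong (f zero +_) (sumF-zero (λ u → off (suc u) λ ()))) (ℚ.+-identityʳ _)
sumF-single (suc v) f off = trans (cong₂ _+_ (off zero λ ()) (sumF-single v (f ∘ suc) off∘suc)) (ℚ.+-identityˡ _)
  where
  off∘suc : ∀ u → u ≢ v → f (suc u) ≡ 0ℚ
  off∘suc u u≢v = off (suc u) (u≢v ∘ suc-injective)

true≢false : true ≢ false
true≢false ()

≡⇒== : ∀ {n} {u w : Fin n} → u ≡ w → (u == w) ≡ true
≡⇒== {u = u} {w} u≡w = trans (isYes≗does (u ≟ w)) (dec-true (u ≟ w) u≡w)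

≢⇒== : ∀ {n} {u w : Fin n} → u ≢ w → (u == w) ≡ false
≢⇒== {u = u} {w} u≢w = trans (isYes≗does (u ≟ w)) (dec-false (u ≟ w) u≢w)

δ-diag : ∀ {n} (u : Fin n) → b2q (u == u) ≡ 1ℚ
δ-diag u = cong b2q (≡⇒== {u = u} refl)

δ-off : ∀ {n} {u w : Fin n} → u ≢ w → b2q (u == w) ≡ 0ℚ
δ-off u≢w = cong b2q (≢⇒== u≢w)

sumF-δʳ : ∀ {n} (u : Fin n) (f : Fin n → ℚ) → sumF (λ k → b2q (k == u) * f k) ≡ f u
sumF-δʳ u f = trans (sumF-single u _ off) (trans (cong (_* f u) (δ-diag u)) (ℚ.*-identityˡ (f u)))
  where
  off : ∀ k → k ≢ u → b2q (k == u) * f k ≡ 0ℚ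
  off k k≢u = trans (cong (_* f k) (δ-off k≢u)) (ℚ.*-zeroˡ (f k))

sumF-δˡ : ∀ {n} (u : Fin n) (f : Fin n → ℚ) → sumF (λ k → b2q (u == k) * f k) ≡ f u
sumF-δˡ u f = trans (sumF-single u _ off) (trans (cong (_* f u) (δ-diag u)) (ℚ.*-identityˡ (f u)))
  where
  off : ∀ k → k ≢ u → b2q (u == k) * f k ≡ 0ℚ
  off k k≢u = trans (cong (_* f k) (δ-off (k≢u ∘ sym))) (ℚ.*-zeroˡ (f k))

sumF-e : ∀ {n} (s : Fin n) → sumF (e s) ≡ 1ℚ
sumF-e s = trans (sumF-cong (λ k → sym (ℚ.*-identityʳ (e s k)))) (sumF-δʳ s (λ _ → 1ℚ))

⋆-e : ∀ {n} (M : Mat n) (s u : Fin n) → (M ⋆ e s) u ≡ M u s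
⋆-e M s u = trans (sumF-cong (λ k → ℚ.*-comm (M u k) (e s k))) (sumF-δʳ s (M u))

⋆-congʳ : ∀ {n} (M : Mat n) {x y : Vect n} → x ≗ y → M ⋆ x ≗ M ⋆ y
⋆-congʳ M x≗y u = sumF-cong (λ k → cong (M u k *_) (x≗y k))

⋆-congˡ : ∀ {n} {M N : Mat n} (x : Vect n) → (∀ u k → M u k ≡ N u k) → M ⋆ x ≗ N ⋆ x
⋆-congˡ x M≡N u = sumF-cong (λ k → cong (_* x k) (M≡N u k))

⋆-distrib-⊕ : ∀ {n} (M : Mat n) (x y : Vect n) → M ⋆ (x ⊕ y) ≗ (M ⋆ x) ⊕ (M ⋆ y)
⋆-distrib-⊕ M x y u = trans (sumF-cong (λ k → ℚ.*-distribˡ-+ (M u k) (x k) (y k)))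
                            (sumF-distrib-+ (λ k → M u k * x k) (λ k → M u k * y k))

⋆-distrib-⊖ : ∀ {n} (M : Mat n) (x y : Vect n) → M ⋆ (x ⊖ y) ≗ (M ⋆ x) ⊖ (M ⋆ y)
⋆-distrib-⊖ M x y u = trans (sumF-cong (λ k → distrib (M u k) (x k) (y k)))
                            (sumF-distrib-- (λ k → M u k * x k) (λ k → M u k * y k))
  where
  distrib : ∀ a b c → a * (b - c) ≡ a * b - a * c
  distrib = solve-∀ ℚ-ring

⋆-scaleʳ : ∀ {n} (M : Mat n) (x : Vect n) γ → M ⋆ (λ k → x k * γ) ≗ λ u → (M ⋆ x) u * γ
⋆-scaleʳ M x γ u = trans (sumF-cong (λ k → sym (ℚ.*-assoc (M u k) (x k) γ))) (sym (*-distribʳ-sumF γ (λ k → M u k * x k)))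

⊗-⋆ : ∀ {n} (A B : Mat n) (x : Vect n) → (A ⊗ B) ⋆ x ≗ A ⋆ (B ⋆ x)
⊗-⋆ A B x u = begin
  sumF (λ k → sumF (λ m → A u m * B m k) * x k)    ≡⟨ sumF-cong (λ k → *-distribʳ-sumF (x k) (λ m → A u m * B m k)) ⟩
  sumF (λ k → sumF (λ m → A u m * B m k * x k))    ≡⟨ sumF-comm (λ m k → A u m * B m k * x k) ⟨
  sumF (λ m → sumF (λ k → A u m * B m k * x k))    ≡⟨ sumF-cong (λ m → sumF-cong (λ k → ℚ.*-assoc (A u m) (B m k) (x k))) ⟩
  sumF (λ m → sumF (λ k → A u m * (B m k * x k)))  ≡⟨ sumF-cong (λ m → *-distribˡ-sumF (A u m) (λ k → B m k * x k)) ⟨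
  sumF (λ m → A u m * (B ⋆ x) m)                   ∎

⊗-assoc : ∀ {n} (A B C : Mat n) u w → ((A ⊗ B) ⊗ C) u w ≡ (A ⊗ (B ⊗ C)) u w
⊗-assoc A B C u w = ⊗-⋆ A B (λ k → C k w) u

⊗-cong : ∀ {n} {A A′ B B′ : Mat n} → (∀ u w → A u w ≡ A′ u w) → (∀ u w → B u w ≡ B′ u w) →
         ∀ u w → (A ⊗ B) u w ≡ (A′ ⊗ B′) u w
⊗-cong A≡A′ B≡B′ u w = sumF-cong (λ k → cong₂ _*_ (A≡A′ u k) (B≡B′ k w))

⊗-transpose : ∀ {n} (A B : Mat n) u w → (A ⊗ B) u w ≡ (transpose B ⊗ transpose A) w u
⊗-transpose A B u w = sumF-cong (λ k → ℚ.*-comm (A u k) (B k w))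

⊗⊗-transpose : ∀ {n} (A B C : Mat n) u w →
               ((A ⊗ B) ⊗ C) u w ≡ ((transpose C ⊗ transpose B) ⊗ transpose A) w u
⊗⊗-transpose A B C u w = begin
  ((A ⊗ B) ⊗ C) u w
    ≡⟨ ⊗-transpose (A ⊗ B) C u w ⟩
  (transpose C ⊗ transpose (A ⊗ B)) w u
    ≡⟨ ⊗-cong {A = transpose C} (λ _ _ → refl) (λ a b → ⊗-transpose A B b a) w u ⟩
  (transpose C ⊗ (transpose B ⊗ transpose A)) w u
    ≡⟨ ⊗-assoc (transpose C) (transpose B) (transpose A) w u ⟨
  ((transpose C ⊗ transpose B) ⊗ transpose A) w u
    ∎

·-comm : ∀ {n} (x y : Vect n) → x · y ≡ y · x
·-comm x y = sumF-cong (λ u → ℚ.*-comm (x u) (y u))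

·-⋆ : ∀ {n} (x : Vect n) (M : Mat n) (y : Vect n) → x · (M ⋆ y) ≡ (transpose M ⋆ x) · y
·-⋆ x M y = begin
  sumF (λ u → x u * sumF (λ k → M u k * y k))    ≡⟨ sumF-cong (λ u → *-distribˡ-sumF (x u) (λ k → M u k * y k)) ⟩
  sumF (λ u → sumF (λ k → x u * (M u k * y k)))  ≡⟨ sumF-comm (λ u k → x u * (M u k * y k)) ⟩
  sumF (λ k → sumF (λ u → x u * (M u k * y k)))  ≡⟨ sumF-cong (λ k → sumF-cong (λ u → reassoc (x u) (M u k) (y k))) ⟩
  sumF (λ k → sumF (λ u → M u k * x u * y k))    ≡⟨ sumF-cong (λ k → *-distribʳ-sumF (y k) (λ u → M u k * x u)) ⟨
  sumF (λ k → (transpose M ⋆ x) k * y k)         ∎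
  where
  reassoc : ∀ a b c → a * (b * c) ≡ b * a * c
  reassoc = solve-∀ ℚ-ring

·-cong-on : ∀ {n} (S : Subset n) {z p q : Vect n} → (∀ k → S k ≡ false → z k ≡ 0ℚ) →
            (∀ k → S k ≡ true → p k ≡ q k) → z · p ≡ z · q
·-cong-on S {z} {p} {q} z-supp p≡q = sumF-cong agree
  where
  agree : ∀ k → z k * p k ≡ z k * q k
  agree k with S k in Sk
  ... | true  = cong (z k *_) (p≡q k Sk)
  ... | false = trans (cong (_* p k) (z-supp k Sk))
                      (trans (ℚ.*-zeroˡ (p k)) (sym (trans (cong (_* q k) (z-supp k Sk)) (ℚ.*-zeroˡ (q k)))))

-- The Laplacian

module _ {n} (G : SimpleGraph n) where

  Amat-sym : ∀ u w → Amat G u w ≡ Amat G w u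
  Amat-sym u w = cong b2q (adj-sym G u w)

  Lap-offdiag : ∀ {u w} → u ≢ w → Lap G u w ≡ - Amat G u w
  Lap-offdiag {u} {w} u≢w rewrite ≢⇒== u≢w = refl

  Lap-diag : ∀ u → Lap G u u ≡ deg G u
  Lap-diag u rewrite ≡⇒== {u = u} refl = refl

  Lap-sym : ∀ u w → Lap G u w ≡ Lap G w u
  Lap-sym u w = by-cases (u ≟ w)
    where
    by-cases : Dec (u ≡ w) → Lap G u w ≡ Lap G w u
    by-cases (yes u≡w) = cong₂ (Lap G) u≡w (sym u≡w)
    by-cases (no  u≢w) = trans (Lap-offdiag u≢w) (trans (cong -_ (Amat-sym u w)) (sym (Lap-offdiag (u≢w ∘ sym))))

  Lap-δ : ∀ u k → Lap G u k ≡ b2q (u == k) * deg G u - Amat G u k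
  Lap-δ u k with u ≟ k
  ... | yes refl = sym (trans (cong (λ a → 1ℚ * deg G u - a) (cong b2q (adj-irrefl G u))) (unit (deg G u)))
    where
    unit : ∀ d → 1ℚ * d - 0ℚ ≡ d
    unit = solve-∀ ℚ-ring
  ... | no  _    = sym (zero-δ (deg G u) (Amat G u k))
    where
    zero-δ : ∀ d a → 0ℚ * d - a ≡ - a
    zero-δ = solve-∀ ℚ-ring

  Lap-⋆ : ∀ z u → (Lap G ⋆ z) u ≡ sumF (λ k → Amat G u k * (z u - z k))
  Lap-⋆ z u = begin
    sumF (λ k → Lap G u k * z k)
      ≡⟨ sumF-cong (λ k → trans (cong (_* z k) (Lap-δ u k))
                               (expand (b2q (u == k)) (deg G u) (Amat G u k) (z k))) ⟩
    sumF (λ k → b2q (u == k) * (deg G u * z k) - Amat G u k * z k)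
      ≡⟨ sumF-distrib-- (λ k → b2q (u == k) * (deg G u * z k)) (λ k → Amat G u k * z k) ⟩
    sumF (λ k → b2q (u == k) * (deg G u * z k)) - sumF (λ k → Amat G u k * z k)
      ≡⟨ cong (_- sumF (λ k → Amat G u k * z k))
              (trans (sumF-δˡ u (λ k → deg G u * z k)) (*-distribʳ-sumF (z u) (Amat G u))) ⟩
    sumF (λ k → Amat G u k * z u) - sumF (λ k → Amat G u k * z k)
      ≡⟨ sumF-distrib-- (λ k → Amat G u k * z u) (λ k → Amat G u k * z k) ⟨
    sumF (λ k → Amat G u k * z u - Amat G u k * z k)
      ≡⟨ sumF-cong (λ k → factor (Amat G u k) (z u) (z k)) ⟩
    sumF (λ k → Amat G u k * (z u - z k))
      ∎
    where
    expand : ∀ δ d a x → (δ * d - a) * x ≡ δ * (d * x) - a * x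
    expand = solve-∀ ℚ-ring
    factor : ∀ a x y → a * x - a * y ≡ a * (x - y)
    factor = solve-∀ ℚ-ring

  Lap-⋆-ones : ∀ u → (Lap G ⋆ ones) u ≡ 0ℚ
  Lap-⋆-ones u = trans (Lap-⋆ ones u) (sumF-zero (λ k → ℚ.*-zeroʳ (Amat G u k)))

  sumF-Lap-⋆≡0 : ∀ z → sumF (Lap G ⋆ z) ≡ 0ℚ
  sumF-Lap-⋆≡0 z = begin
    sumF (λ u → sumF (λ k → Lap G u k * z k))  ≡⟨ sumF-comm (λ u k → Lap G u k * z k) ⟩
    sumF (λ k → sumF (λ u → Lap G u k * z k))  ≡⟨ sumF-cong (λ k → *-distribʳ-sumF (z k) (λ u → Lap G u k)) ⟨
    sumF (λ k → sumF (λ u → Lap G u k) * z k)  ≡⟨ sumF-zero (λ k → trans (cong (_* z k) (column-sum k)) (ℚ.*-zeroˡ (z k))) ⟩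
    0ℚ                                         ∎
    where
    column-sum : ∀ k → sumF (λ u → Lap G u k) ≡ 0ℚ
    column-sum k = trans (sumF-cong (λ u → trans (Lap-sym u k) (sym (ℚ.*-identityʳ (Lap G k u))))) (Lap-⋆-ones k)

  Lap-⋆-off-support : ∀ {S : Subset n} {z : Vect n} {u} → (∀ k → S k ≡ false → z k ≡ 0ℚ) → S u ≡ false →
                      (∀ k → S k ≡ true → adj G u k ≡ false) → (Lap G ⋆ z) u ≡ 0ℚ
  Lap-⋆-off-support {S} {z} {u} z-supp Su u↮S = sumF-zero term
    where
    term : ∀ k → Lap G u k * z k ≡ 0ℚ
    term k with S k in Sk
    ... | true  = trans (cong (_* z k) (trans (Lap-offdiag u≢k) (cong (λ b → - b2q b) (u↮S k Sk))))
                        (ℚ.*-zeroˡ (z k))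
      where
      u≢k : u ≢ k
      u≢k refl = true≢false (trans (sym Sk) Su)
    ... | false = trans (cong (Lap G u k *_) (z-supp k Sk)) (ℚ.*-zeroʳ (Lap G u k))

-- Padded solutions and bordering

IsPaddedSolution : ∀ {n} → Mat n → Subset n → Vect n → Vect n → Set
IsPaddedSolution L S x z = (∀ u → S u ≡ false → z u ≡ 0ℚ) × (∀ u → S u ≡ true → (L ⋆ z) u ≡ x u)

IsPaddedSolution-cong : ∀ {n} (L : Mat n) {S x z z′} → z ≗ z′ →
                        IsPaddedSolution L S x z → IsPaddedSolution L S x z′
IsPaddedSolution-cong L z≗z′ (z-supp , Lz≡x) =
  (λ u Su → trans (sym (z≗z′ u)) (z-supp u Su)) ,
  (λ u Su → trans (sym (⋆-congʳ L z≗z′ u)) (Lz≡x u Su))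

paddedInverse-row : ∀ {n} (L : Mat n) {S X u} → IsPaddedInverse L S X → S u ≡ true →
                    ∀ w → (L ⊗ X) u w ≡ b2q (u == w)
paddedInverse-row L {S} {X} {u} (rows , cols , inverse) Su w with S w in Sw
... | true  = trans (sumF-cong restrict) (inverse u w Su Sw)
  where
  restrict : ∀ k → L u k * X k w ≡ b2q (S k) * (L u k * X k w)
  restrict k with S k in Sk
  ... | true  = sym (ℚ.*-identityˡ (L u k * X k w))
  ... | false = trans (cong (L u k *_) (rows k w Sk))
                      (trans (ℚ.*-zeroʳ (L u k)) (sym (ℚ.*-zeroˡ (L u k * X k w))))
... | false = trans (sumF-zero (λ k → trans (cong (L u k *_) (cols k w Sw)) (ℚ.*-zeroʳ (L u k))))
                    (sym (δ-off {u = u} {w} λ { refl → true≢false (trans (sym Su) Sw) }))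

paddedInverse-solves : ∀ {n} (L : Mat n) {S X} → IsPaddedInverse L S X →
                       ∀ x → IsPaddedSolution L S x (X ⋆ x)
paddedInverse-solves L {S} {X} X⁻¹@(rows , _) x = vanishes , solves
  where
  vanishes : ∀ u → S u ≡ false → (X ⋆ x) u ≡ 0ℚ
  vanishes u Su = sumF-zero (λ k → trans (cong (_* x k) (rows u k Su)) (ℚ.*-zeroˡ (x k)))
  solves : ∀ u → S u ≡ true → (L ⋆ (X ⋆ x)) u ≡ x u
  solves u Su = begin
    (L ⋆ (X ⋆ x)) u                    ≡⟨ ⊗-⋆ L X x u ⟨
    ((L ⊗ X) ⋆ x) u                    ≡⟨ ⋆-congˡ x (λ _ → paddedInverse-row L X⁻¹ Su) u ⟩
    sumF (λ k → b2q (u == k) * x k)    ≡⟨ sumF-δˡ u x ⟩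
    x u                                ∎

module _ {n} (G : SimpleGraph n) where

  Lap-⋆-paddedInverse-column : ∀ {S A : Subset n} {X s} → IsPaddedInverse (Lap G) A X → A s ≡ true →
    (∀ u k → S u ≡ true → A u ≡ false → A k ≡ true → adj G u k ≡ false) →
    ∀ u → S u ≡ true → (Lap G ⋆ (X ⋆ e s)) u ≡ e s u
  Lap-⋆-paddedInverse-column {S} {A} {X} {s} X⁻¹ As S↮A u Su with A u in Au
  ... | true  = proj₂ (paddedInverse-solves (Lap G) X⁻¹ (e s)) u Au
  ... | false = trans (Lap-⋆-off-support G (proj₁ (paddedInverse-solves (Lap G) X⁻¹ (e s))) Au (λ k → S↮A u k Su Au))
                      (sym (δ-off u≢s))
    where
    u≢s : u ≢ s
    u≢s refl = true≢false (trans (sym As) Au)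

  paddedSolution-two-components : ∀ {S Vs Vt : Subset n} {Xs Xt s t} →
    (∀ u → S u ≡ (Vs u ∨ Vt u)) → (∀ u w → Vs u ≡ true → Vt w ≡ true → adj G u w ≡ false) →
    Vs s ≡ true → Vt t ≡ true → IsPaddedInverse (Lap G) Vs Xs → IsPaddedInverse (Lap G) Vt Xt →
    IsPaddedSolution (Lap G) S (e s ⊖ e t) ((Xs ⋆ e s) ⊖ (Xt ⋆ e t))
  paddedSolution-two-components {S} {Vs} {Vt} {Xs} {Xt} {s} {t} S≡Vs∨Vt Vs↮Vt Vs-s Vt-t Xs⁻¹ Xt⁻¹ =
    vanishes , solves
    where
    vanishes : ∀ u → S u ≡ false → ((Xs ⋆ e s) ⊖ (Xt ⋆ e t)) u ≡ 0ℚ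
    vanishes u Su = cong₂ _-_ (proj₁ (paddedInverse-solves (Lap G) Xs⁻¹ (e s)) u (∨-conicalˡ _ _ Vs∨Vt))
                              (proj₁ (paddedInverse-solves (Lap G) Xt⁻¹ (e t)) u (∨-conicalʳ _ _ Vs∨Vt))
      where
      Vs∨Vt : (Vs u ∨ Vt u) ≡ false
      Vs∨Vt = trans (sym (S≡Vs∨Vt u)) Su
    Vt-outside-Vs : ∀ u k → S u ≡ true → Vs u ≡ false → Vs k ≡ true → adj G u k ≡ false
    Vt-outside-Vs u k Su Vs-u Vs-k =
      trans (adj-sym G u k) (Vs↮Vt k u Vs-k (trans (sym (cong (_∨ Vt u) Vs-u)) (trans (sym (S≡Vs∨Vt u)) Su)))
    Vs-outside-Vt : ∀ u k → S u ≡ true → Vt u ≡ false → Vt k ≡ true → adj G u k ≡ false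
    Vs-outside-Vt u k Su Vt-u Vt-k =
      Vs↮Vt u k (trans (sym (trans (cong (Vs u ∨_) Vt-u) (∨-identityʳ (Vs u)))) (trans (sym (S≡Vs∨Vt u)) Su)) Vt-k
    solves : ∀ u → S u ≡ true → (Lap G ⋆ ((Xs ⋆ e s) ⊖ (Xt ⋆ e t))) u ≡ (e s ⊖ e t) u
    solves u Su = trans (⋆-distrib-⊖ (Lap G) (Xs ⋆ e s) (Xt ⋆ e t) u)
                        (cong₂ _-_ (Lap-⋆-paddedInverse-column Xs⁻¹ Vs-s Vt-outside-Vs u Su)
                                   (Lap-⋆-paddedInverse-column Xt⁻¹ Vt-t Vs-outside-Vt u Su))

  paddedSolution-extends : ∀ {S : Subset n} {x z : Vect n} (v : Fin n) → (∀ u → u ≢ v → S u ≡ true) →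
    sumF x ≡ 0ℚ → IsPaddedSolution (Lap G) S x z → ∀ u → (Lap G ⋆ z) u ≡ x u
  paddedSolution-extends {S} {x} {z} v S⊇V-v Σx≡0 (_ , Lz≡x) u = by-cases (u ≟ v)
    where
    residual : Vect n
    residual = (Lap G ⋆ z) ⊖ x
    residual-off-v : ∀ u → u ≢ v → residual u ≡ 0ℚ
    residual-off-v u u≢v = trans (cong (_- x u) (Lz≡x u (S⊇V-v u u≢v))) (ℚ.+-inverseʳ (x u))
    residual-v : residual v ≡ 0ℚ
    residual-v = begin
      residual v                        ≡⟨ sumF-single v residual residual-off-v ⟨
      sumF residual                     ≡⟨ sumF-distrib-- (Lap G ⋆ z) x ⟩
      sumF (Lap G ⋆ z) - sumF x         ≡⟨ cong₂ _-_ (sumF-Lap-⋆≡0 G z) Σx≡0 ⟩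
      0ℚ                                ∎
    by-cases : Dec (u ≡ v) → (Lap G ⋆ z) u ≡ x u
    by-cases (yes refl) = x∙y⁻¹≈ε⇒x≈y ((Lap G ⋆ z) u) (x u) residual-v
    by-cases (no  u≢v)  = Lz≡x u (S⊇V-v u u≢v)

-- Block inversion through the Schur complement: L_{S₀}⁻¹ is the padded L_{S₁}⁻¹ plus M̃_c.
record Bordering {n} (G : SimpleGraph n) (S₀ S₁ : Subset n) (c : Fin n) (Y : Mat n) (σ : ℚ) : Set where
  field
    S₁≡S₀-c   : ∀ u → S₁ u ≡ (S₀ u ∧ not (u == c))
    c∈S₀      : S₀ c ≡ true
    Y-inverse : IsPaddedInverse (Lap G) S₁ Y
    σ-inverse : σ * schur G S₁ Y c ≡ 1ℚ

module BorderingStep {n} {G : SimpleGraph n} {S₀ S₁ c Y σ} (B : Bordering G S₀ S₁ c Y σ) where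
  open Bordering B

  a : Vect n
  a = aVec G S₁ c

  w : Vect n
  w = wVec G S₁ Y c

  c∉S₁ : S₁ c ≡ false
  c∉S₁ = trans (S₁≡S₀-c c) (trans (cong (λ b → S₀ c ∧ not b) (≡⇒== {u = c} refl)) (∧-zeroʳ (S₀ c)))

  S₁≡S₀ : ∀ {u} → u ≢ c → S₁ u ≡ S₀ u
  S₁≡S₀ {u} u≢c = trans (S₁≡S₀-c u) (trans (cong (λ b → S₀ u ∧ not b) (≢⇒== u≢c)) (∧-identityʳ (S₀ u)))

  ∈S₁⇒≢c : ∀ {u} → S₁ u ≡ true → u ≢ c
  ∈S₁⇒≢c S₁u refl = true≢false (trans (sym S₁u) c∉S₁)

  ∉S₀⇒≢c : ∀ {u} → S₀ u ≡ false → u ≢ c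
  ∉S₀⇒≢c S₀u refl = true≢false (trans (sym c∈S₀) S₀u)

  Y⋆a-solves : IsPaddedSolution (Lap G) S₁ a (Y ⋆ a)
  Y⋆a-solves = paddedInverse-solves (Lap G) Y-inverse a

  Lᵀ⋆Y⋆a-on-S₁ : ∀ k → S₁ k ≡ true → (transpose (Lap G) ⋆ (Y ⋆ a)) k ≡ a k
  Lᵀ⋆Y⋆a-on-S₁ k S₁k = trans (⋆-congˡ (Y ⋆ a) (λ u m → Lap-sym G m u) k) (proj₂ Y⋆a-solves k S₁k)

  a-on-S₁ : ∀ {k} → S₁ k ≡ true → a k ≡ Amat G c k
  a-on-S₁ {k} S₁k = trans (cong (λ b → b2q b * Amat G c k) S₁k) (ℚ.*-identityˡ (Amat G c k))

  Lap-⋆-at-c : ∀ {q} → (∀ k → S₁ k ≡ false → q k ≡ 0ℚ) → (Lap G ⋆ q) c ≡ - (a · q)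
  Lap-⋆-at-c {q} q-supp = trans (sumF-cong term) (sumF-neg (λ k → a k * q k))
    where
    term : ∀ k → Lap G c k * q k ≡ - (a k * q k)
    term k with S₁ k in S₁k
    ... | true  = begin
      Lap G c k * q k     ≡⟨ cong (_* q k) (Lap-offdiag G (∈S₁⇒≢c S₁k ∘ sym)) ⟩
      - Amat G c k * q k  ≡⟨ ℚ.neg-distribˡ-* (Amat G c k) (q k) ⟨
      - (Amat G c k * q k) ≡⟨ cong (λ t → - (t * q k)) (ℚ.*-identityˡ (Amat G c k)) ⟨
      - (1ℚ * Amat G c k * q k) ∎
    ... | false = trans (cong (Lap G c k *_) (q-supp k S₁k)) (trans (ℚ.*-zeroʳ (Lap G c k))
                        (sym (cong -_ (trans (cong (_* q k) (ℚ.*-zeroˡ (Amat G c k))) (ℚ.*-zeroˡ (q k))))))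

  Lap-⋆-w : ∀ u → (Lap G ⋆ w) u ≡ (Lap G ⋆ (Y ⋆ a)) u + Lap G u c
  Lap-⋆-w u = trans (⋆-distrib-⊕ (Lap G) (Y ⋆ a) (e c) u) (cong ((Lap G ⋆ (Y ⋆ a)) u +_) (⋆-e (Lap G) c u))

  Lap-⋆-w-on-S₁ : ∀ {u} → S₁ u ≡ true → (Lap G ⋆ w) u ≡ 0ℚ
  Lap-⋆-w-on-S₁ {u} S₁u = begin
    (Lap G ⋆ w) u                        ≡⟨ Lap-⋆-w u ⟩
    (Lap G ⋆ (Y ⋆ a)) u + Lap G u c      ≡⟨ cong₂ _+_ (trans (proj₂ Y⋆a-solves u S₁u) (a-on-S₁ S₁u))
                                                      (Lap-offdiag G (∈S₁⇒≢c S₁u)) ⟩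
    Amat G c u + - Amat G u c            ≡⟨ cong (λ t → t + - Amat G u c) (Amat-sym G c u) ⟩
    Amat G u c + - Amat G u c            ≡⟨ ℚ.+-inverseʳ (Amat G u c) ⟩
    0ℚ                                   ∎

  Lap-⋆-w-at-c : (Lap G ⋆ w) c ≡ schur G S₁ Y c
  Lap-⋆-w-at-c = trans (Lap-⋆-w c) (trans (cong₂ _+_ (Lap-⋆-at-c (proj₁ Y⋆a-solves)) (Lap-diag G c))
                                          (ℚ.+-comm (- (a · (Y ⋆ a))) (deg G c)))

  w-off-S₀ : ∀ {u} → S₀ u ≡ false → w u ≡ 0ℚ
  w-off-S₀ {u} S₀u = cong₂ _+_ (proj₁ Y⋆a-solves u (trans (S₁≡S₀ (∉S₀⇒≢c S₀u)) S₀u)) (δ-off (∉S₀⇒≢c S₀u))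

  Mtilde-⋆ : ∀ x u → (Mtilde G S₁ Y c σ ⋆ x) u ≡ w u * (σ * (w · x))
  Mtilde-⋆ x u = trans (sumF-cong (λ k → reassoc (w u) σ (w k) (x k)))
                       (trans (sym (*-distribˡ-sumF (w u * σ) (λ k → w k * x k))) (ℚ.*-assoc (w u) σ (w · x)))
    where
    reassoc : ∀ p q r s → p * (q * r) * s ≡ p * q * (r * s)
    reassoc = solve-∀ ℚ-ring

  w·x : ∀ {x z} → IsPaddedSolution (Lap G) S₁ x z → w · x ≡ a · z + x c
  w·x {x} {z} (z-supp , Lz≡x) = begin
    w · x                                   ≡⟨ sumF-cong (λ k → ℚ.*-distribʳ-+ (x k) ((Y ⋆ a) k) (e c k)) ⟩
    sumF (λ k → (Y ⋆ a) k * x k + e c k * x k) ≡⟨ sumF-distrib-+ (λ k → (Y ⋆ a) k * x k) (λ k → e c k * x k) ⟩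
    (Y ⋆ a) · x + sumF (λ k → e c k * x k)  ≡⟨ cong₂ _+_ Ya·x (sumF-δʳ c x) ⟩
    a · z + x c                             ∎
    where
    Ya·x : (Y ⋆ a) · x ≡ a · z
    Ya·x = begin
      (Y ⋆ a) · x                          ≡⟨ ·-cong-on S₁ (proj₁ Y⋆a-solves) (λ k S₁k → sym (Lz≡x k S₁k)) ⟩
      (Y ⋆ a) · (Lap G ⋆ z)                ≡⟨ ·-⋆ (Y ⋆ a) (Lap G) z ⟩
      (transpose (Lap G) ⋆ (Y ⋆ a)) · z    ≡⟨ ·-comm _ z ⟩
      z · (transpose (Lap G) ⋆ (Y ⋆ a))    ≡⟨ ·-cong-on S₁ z-supp Lᵀ⋆Y⋆a-on-S₁ ⟩
      z · a                                ≡⟨ ·-comm z a ⟩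
      a · z                                ∎

  Lap-⋆-bordered : ∀ x z u → (Lap G ⋆ (z ⊕ (Mtilde G S₁ Y c σ ⋆ x))) u ≡ (Lap G ⋆ z) u + (Lap G ⋆ w) u * (σ * (w · x))
  Lap-⋆-bordered x z u = trans (⋆-distrib-⊕ (Lap G) z _ u)
    (cong ((Lap G ⋆ z) u +_) (trans (⋆-congʳ (Lap G) (Mtilde-⋆ x) u) (⋆-scaleʳ (Lap G) w (σ * (w · x)) u)))

  bordered-solves-at-c : ∀ {x z} → IsPaddedSolution (Lap G) S₁ x z → (Lap G ⋆ (z ⊕ (Mtilde G S₁ Y c σ ⋆ x))) c ≡ x c
  bordered-solves-at-c {x} {z} z-sol@(z-supp , _) = begin
    (Lap G ⋆ (z ⊕ (Mtilde G S₁ Y c σ ⋆ x))) c          ≡⟨ Lap-⋆-bordered x z c ⟩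
    (Lap G ⋆ z) c + (Lap G ⋆ w) c * (σ * (w · x))      ≡⟨ cong₂ (λ p q → p + q * (σ * (w · x)))
                                                                (Lap-⋆-at-c z-supp) Lap-⋆-w-at-c ⟩
    - (a · z) + schur G S₁ Y c * (σ * (w · x))         ≡⟨ cong (λ t → - (a · z) + schur G S₁ Y c * (σ * t)) (w·x z-sol) ⟩
    - (a · z) + schur G S₁ Y c * (σ * (a · z + x c))   ≡⟨ cong (- (a · z) +_) (reassoc (schur G S₁ Y c) σ (a · z + x c)) ⟩
    - (a · z) + σ * schur G S₁ Y c * (a · z + x c)     ≡⟨ cong (λ t → - (a · z) + t * (a · z + x c)) σ-inverse ⟩
    - (a · z) + 1ℚ * (a · z + x c)                     ≡⟨ cancel (a · z) (x c) ⟩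
    x c                                                ∎
    where
    reassoc : ∀ p q r → p * (q * r) ≡ q * p * r
    reassoc = solve-∀ ℚ-ring
    cancel : ∀ p q → - p + 1ℚ * (p + q) ≡ q
    cancel = solve-∀ ℚ-ring

  paddedSolution : ∀ {x z} → IsPaddedSolution (Lap G) S₁ x z → IsPaddedSolution (Lap G) S₀ x (z ⊕ (Mtilde G S₁ Y c σ ⋆ x))
  paddedSolution {x} {z} z-sol@(z-supp , Lz≡x) = vanishes , solves
    where
    γ : ℚ
    γ = σ * (w · x)
    vanishes : ∀ u → S₀ u ≡ false → z u + (Mtilde G S₁ Y c σ ⋆ x) u ≡ 0ℚ
    vanishes u S₀u = cong₂ _+_ (z-supp u (trans (S₁≡S₀ (∉S₀⇒≢c S₀u)) S₀u))
                               (trans (Mtilde-⋆ x u) (trans (cong (_* γ) (w-off-S₀ S₀u)) (ℚ.*-zeroˡ γ)))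
    solves : ∀ u → S₀ u ≡ true → (Lap G ⋆ (z ⊕ (Mtilde G S₁ Y c σ ⋆ x))) u ≡ x u
    solves u S₀u with u ≟ c
    ... | yes refl = bordered-solves-at-c z-sol
    ... | no  u≢c  = begin
      (Lap G ⋆ (z ⊕ (Mtilde G S₁ Y c σ ⋆ x))) u  ≡⟨ Lap-⋆-bordered x z u ⟩
      (Lap G ⋆ z) u + (Lap G ⋆ w) u * γ          ≡⟨ cong₂ (λ p q → p + q * γ) (Lz≡x u S₁u) (Lap-⋆-w-on-S₁ S₁u) ⟩
      x u + 0ℚ * γ                               ≡⟨ cong (x u +_) (ℚ.*-zeroˡ γ) ⟩
      x u + 0ℚ                                   ≡⟨ ℚ.+-identityʳ (x u) ⟩
      x u                                        ∎
      where
      S₁u : S₁ u ≡ true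
      S₁u = trans (S₁≡S₀ u≢c) S₀u

paddedSolution-bordering-chain : ∀ {n} {G : SimpleGraph n} {j} (S : ℕ → Subset n) (c : Fin j → Fin n)
  (Y : Fin j → Mat n) (σ : Fin j → ℚ) →
  (∀ k → Bordering G (S (toℕ k)) (S (suc (toℕ k))) (c k) (Y k) (σ k)) →
  ∀ {x z} → IsPaddedSolution (Lap G) (S j) x z →
  IsPaddedSolution (Lap G) (S 0) x (z ⊕ sumFin (λ k → Mtilde G (S (suc (toℕ k))) (Y k) (c k) (σ k) ⋆ x))
paddedSolution-bordering-chain {G = G} {zero} S c Y σ B {z = z} z-sol =
  IsPaddedSolution-cong (Lap G) (λ u → sym (ℚ.+-identityʳ (z u))) z-sol
paddedSolution-bordering-chain {n} {G} {suc j} S c Y σ B {x} {z} z-sol =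
  IsPaddedSolution-cong (Lap G) regroup
    (BorderingStep.paddedSolution (B zero)
      (paddedSolution-bordering-chain (S ∘ suc) (c ∘ suc) (Y ∘ suc) (σ ∘ suc) (B ∘ suc) z-sol))
  where
  first : Vect n
  first = Mtilde G (S 1) (Y zero) (c zero) (σ zero) ⋆ x
  rest : Vect n
  rest = sumFin (λ k → Mtilde G (S (suc (suc (toℕ k)))) (Y (suc k)) (c (suc k)) (σ (suc k)) ⋆ x)
  regroup : ∀ u → (z u + rest u) + first u ≡ z u + (first u + rest u)
  regroup u = swap (z u) (rest u) (first u)
    where
    swap : ∀ p q r → (p + q) + r ≡ p + (r + q)
    swap = solve-∀ ℚ-ring

-- The kernel of a connected Laplacian

sumF-nonneg : ∀ {n} {f : Fin n → ℚ} → (∀ u → 0ℚ ≤ f u) → 0ℚ ≤ sumF f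
sumF-nonneg {zero}  f≥0 = ℚ.≤-refl
sumF-nonneg {suc n} f≥0 = ℚ.+-mono-≤ (f≥0 zero) (sumF-nonneg (f≥0 ∘ suc))

term≤sumF : ∀ {n} {f : Fin n → ℚ} → (∀ u → 0ℚ ≤ f u) → ∀ u → f u ≤ sumF f
term≤sumF {f = f} f≥0 zero =
  subst (_≤ f zero + sumF (f ∘ suc)) (ℚ.+-identityʳ (f zero)) (ℚ.+-monoʳ-≤ (f zero) (sumF-nonneg (f≥0 ∘ suc)))
term≤sumF {f = f} f≥0 (suc u) = ℚ.≤-trans (term≤sumF (f≥0 ∘ suc) u)
  (subst (_≤ f zero + sumF (f ∘ suc)) (ℚ.+-identityˡ (sumF (f ∘ suc))) (ℚ.+-monoˡ-≤ (sumF (f ∘ suc)) (f≥0 zero)))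

nonneg-sumF≡0⇒≡0 : ∀ {n} {f : Fin n → ℚ} → (∀ u → 0ℚ ≤ f u) → sumF f ≡ 0ℚ → ∀ u → f u ≡ 0ℚ
nonneg-sumF≡0⇒≡0 f≥0 Σf≡0 u = ℚ.≤-antisym (subst (_ ≤_) Σf≡0 (term≤sumF f≥0 u)) (f≥0 u)

argmax : ∀ {m} (f : Fin (suc m) → ℚ) → Σ (Fin (suc m)) λ a → ∀ k → f k ≤ f a
argmax {zero}  f = zero , λ { zero → ℚ.≤-refl }
argmax {suc m} f with argmax (f ∘ suc) | ℚ.≤-total (f zero) (f (suc (proj₁ (argmax (f ∘ suc)))))
... | a , f≤fa | inj₁ f0≤fa = suc a , λ { zero → f0≤fa ; (suc k) → f≤fa k }
... | a , f≤fa | inj₂ fa≤f0 = zero  , λ { zero → ℚ.≤-refl ; (suc k) → ℚ.≤-trans (f≤fa k) fa≤f0 }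

q≤p⇒0≤p-q : ∀ {p q : ℚ} → q ≤ p → 0ℚ ≤ p - q
q≤p⇒0≤p-q {p} {q} q≤p = subst (_≤ p - q) (ℚ.+-inverseʳ q) (ℚ.+-monoˡ-≤ (- q) q≤p)

-- Maximum principle: a maximum of z is shared by all neighbours, hence by the whole connected graph.
Lap-kernel-constant : ∀ {n} (G : SimpleGraph n) → Connected G → ∀ {z : Vect n} →
                      (∀ u → (Lap G ⋆ z) u ≡ 0ℚ) → ∀ u w → z u ≡ z w
Lap-kernel-constant {suc m} G conn {z} Lz≡0 u w =
  trans (spreads (conn top u) top-maximal) (sym (spreads (conn top w) top-maximal))
  where
  Maximal : Fin (suc m) → Set
  Maximal b = ∀ k → z k ≤ z b
  top : Fin (suc m)
  top = proj₁ (argmax z)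
  top-maximal : Maximal top
  top-maximal = proj₂ (argmax z)
  neighbour-maximal : ∀ {b c} → Maximal b → adj G b c ≡ true → z c ≡ z b
  neighbour-maximal {b} {c} b-max bc = sym (x∙y⁻¹≈ε⇒x≈y (z b) (z c) (begin
    z b - z c                           ≡⟨ ℚ.*-identityˡ (z b - z c) ⟨
    b2q true * (z b - z c)              ≡⟨ cong (λ t → b2q t * (z b - z c)) bc ⟨
    Amat G b c * (z b - z c)            ≡⟨ nonneg-sumF≡0⇒≡0 term≥0 (trans (sym (Lap-⋆ G z b)) (Lz≡0 b)) c ⟩
    0ℚ                                  ∎))
    where
    term≥0 : ∀ k → 0ℚ ≤ Amat G b k * (z b - z k)
    term≥0 k with adj G b k
    ... | true  = subst (0ℚ ≤_) (sym (ℚ.*-identityˡ (z b - z k))) (q≤p⇒0≤p-q (b-max k))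
    ... | false = subst (0ℚ ≤_) (sym (ℚ.*-zeroˡ (z b - z k))) ℚ.≤-refl
  spreads : ∀ {b c} → Reach G b c → Maximal b → z c ≡ z b
  spreads here          b-max = refl
  spreads {b} (step {w = b′} bb′ b′c) b-max = trans (spreads b′c (λ k → subst (z k ≤_) (sym b′≡b) (b-max k))) b′≡b
    where
    b′≡b : z b′ ≡ z b
    b′≡b = neighbour-maximal b-max bb′

-- The pseudoinverse of the Laplacian

ℕ→ℚ : ℕ → ℚ
ℕ→ℚ k = mkℚ (ℤ.+ k) 0 (Cop.sym (Cop.1-coprimeTo k))

sumF-1≡ℕ→ℚ : ∀ k → sumF {k} (λ _ → 1ℚ) ≡ ℕ→ℚ k
sumF-1≡ℕ→ℚ zero    = refl
sumF-1≡ℕ→ℚ (suc k) = trans (cong (1ℚ +_) (sumF-1≡ℕ→ℚ k))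
  (ℚ.toℚᵘ-injective (ℚᵘ.≃-trans (ℚ.toℚᵘ-homo-+ 1ℚ (ℕ→ℚ k)) (ℚᵘ.*≡* (1+k (ℤ.+ k)))))
  where
  1+k : ∀ (i : ℤ) → (1ℤ ℤ.* 1ℤ ℤ.+ i ℤ.* 1ℤ) ℤ.* 1ℤ ≡ (1ℤ ℤ.+ i) ℤ.* 1ℤ
  1+k = ℤ-solve-∀

-- The Fin n argument only witnesses n ≥ 1 (invℕ 0 is 0).
sumF-1*invℕ : ∀ {n} → Fin n → sumF {n} (λ _ → 1ℚ) * invℕ n ≡ 1ℚ
sumF-1*invℕ {suc m} _ =
  trans (cong₂ _*_ (sumF-1≡ℕ→ℚ (suc m)) (ℚ.↥p/↧p≡p (mkℚ (ℤ.+ 1) m (Cop.1-coprimeTo (suc m)))))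
        (ℚ.*-inverseʳ (ℕ→ℚ (suc m)))

centred : ∀ {n} → Vect n → Vect n
centred {n} y u = y u - invℕ n * (ones · y)

centred-·-centred : ∀ {n} → Fin n → (y : Vect n) →
                    centred y · centred y ≡ y · y - invℕ n * ((ones · y) * (ones · y))
centred-·-centred {n} v y = begin
  sumF (λ u → (y u - m) * (y u - m))
    ≡⟨ sumF-cong (λ u → square (y u) m) ⟩
  sumF (λ u → (y u * y u - (m + m) * (1ℚ * y u)) + m * m * 1ℚ)
    ≡⟨ sumF-distrib-+ (λ u → y u * y u - (m + m) * (1ℚ * y u)) (λ _ → m * m * 1ℚ) ⟩
  sumF (λ u → y u * y u - (m + m) * (1ℚ * y u)) + sumF {n} (λ _ → m * m * 1ℚ)
    ≡⟨ cong₂ _+_ (sumF-distrib-- (λ u → y u * y u) (λ u → (m + m) * (1ℚ * y u)))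
                 (sym (*-distribˡ-sumF {n} (m * m) (λ _ → 1ℚ))) ⟩
  (y · y - sumF (λ u → (m + m) * (1ℚ * y u))) + m * m * N
    ≡⟨ cong (λ t → (y · y - t) + m * m * N) (*-distribˡ-sumF (m + m) (λ u → 1ℚ * y u)) ⟨
  (y · y - (m + m) * S) + m * m * N
    ≡⟨ expand (y · y) (invℕ n) S N ⟩
  y · y - invℕ n * (S * S) + (N * invℕ n - 1ℚ) * (invℕ n * (S * S))
    ≡⟨ cong (λ t → y · y - invℕ n * (S * S) + (t - 1ℚ) * (invℕ n * (S * S))) (sumF-1*invℕ v) ⟩
  y · y - invℕ n * (S * S) + (1ℚ - 1ℚ) * (invℕ n * (S * S))
    ≡⟨ vanish (y · y - invℕ n * (S * S)) (invℕ n * (S * S)) ⟩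
  y · y - invℕ n * (S * S)
    ∎
  where
  S : ℚ
  S = ones · y
  N : ℚ
  N = sumF {n} (λ _ → 1ℚ)
  m : ℚ
  m = invℕ n * S
  square : ∀ a b → (a - b) * (a - b) ≡ (a * a - (b + b) * (1ℚ * a)) + b * b * 1ℚ
  square = solve-∀ ℚ-ring
  -- N * I − 1 (which is 0) is kept as a separate term so that this is a plain ring identity.
  expand : ∀ Y I S N → (Y - (I * S + I * S) * S) + I * S * (I * S) * N ≡ Y - I * (S * S) + (N * I - 1ℚ) * (I * (S * S))
  expand = solve-∀ ℚ-ring
  vanish : ∀ a b → a + (1ℚ - 1ℚ) * b ≡ a
  vanish = solve-∀ ℚ-ring

-- The {1,4}-generalised inverses (Penrose equations 1 and 4), stated pointwise.
IsMinNormGInverse : ∀ {n} → Mat n → Mat n → Set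
IsMinNormGInverse L P = (∀ u w → ((L ⊗ P) ⊗ L) u w ≡ L u w) × (∀ u w → (P ⊗ L) u w ≡ (P ⊗ L) w u)

pseudoInverse⇒minNormGInverse : ∀ {n} {L P : Mat n} → IsPseudoInverse L P → IsMinNormGInverse L P
pseudoInverse⇒minNormGInverse (LPL≡L , _ , _ , PL-sym) =
  (λ u w → cong (λ M → M u w) LPL≡L) , (λ u w → sym (cong (λ M → M u w) PL-sym))

pseudoInverse⇒transpose-minNormGInverse : ∀ {n} {L P : Mat n} → (∀ u w → L u w ≡ L w u) →
  IsPseudoInverse L P → IsMinNormGInverse L (transpose P)
pseudoInverse⇒transpose-minNormGInverse {L = L} {P} L-sym (LPL≡L , _ , LP-sym , _) = LPᵀL≡L , PᵀL-sym
  where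
  LPᵀL≡L : ∀ u w → ((L ⊗ transpose P) ⊗ L) u w ≡ L u w
  LPᵀL≡L u w = begin
    ((L ⊗ transpose P) ⊗ L) u w              ≡⟨ ⊗⊗-transpose L (transpose P) L u w ⟩
    ((transpose L ⊗ P) ⊗ transpose L) w u    ≡⟨ ⊗-cong (⊗-cong (λ a b → L-sym b a) (λ _ _ → refl)) (λ a b → L-sym b a) w u ⟩
    ((L ⊗ P) ⊗ L) w u                        ≡⟨ cong (λ M → M w u) LPL≡L ⟩
    L w u                                    ≡⟨ L-sym w u ⟩
    L u w                                    ∎
  PᵀL≡LP : ∀ u w → (transpose P ⊗ L) u w ≡ (L ⊗ P) w u
  PᵀL≡LP u w = trans (⊗-transpose (transpose P) L u w) (⊗-cong {B = P} (λ a b → L-sym b a) (λ _ _ → refl) w u)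
  PᵀL-sym : ∀ u w → (transpose P ⊗ L) u w ≡ (transpose P ⊗ L) w u
  PᵀL-sym u w = trans (PᵀL≡LP u w) (trans (cong (λ M → M u w) LP-sym) (sym (PᵀL≡LP w u)))

S+N*β≡0⇒β≡-I*S : ∀ {N I S β : ℚ} → N * I ≡ 1ℚ → S + N * β ≡ 0ℚ → β ≡ - (I * S)
S+N*β≡0⇒β≡-I*S {N} {I} {S} {β} N*I≡1 S+Nβ≡0 = begin
  β                          ≡⟨ ℚ.*-identityʳ β ⟨
  β * 1ℚ                     ≡⟨ cong (β *_) N*I≡1 ⟨
  β * (N * I)                ≡⟨ regroup β N I S ⟩
  I * (S + N * β) - I * S    ≡⟨ cong (λ t → I * t - I * S) S+Nβ≡0 ⟩
  I * 0ℚ - I * S             ≡⟨ cancel I S ⟩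
  - (I * S)                  ∎
  where
  regroup : ∀ β N I S → β * (N * I) ≡ I * (S + N * β) - I * S
  regroup = solve-∀ ℚ-ring
  cancel : ∀ I S → I * 0ℚ - I * S ≡ - (I * S)
  cancel = solve-∀ ℚ-ring

-- P L y − y is in ker L, hence constant, and 𝟙ᵀ P L y = 0 because P L is symmetric and kills 𝟙.
minNormGInverse-Lap : ∀ {n} (G : SimpleGraph n) → Connected G → Fin n → ∀ {P} →
                      IsMinNormGInverse (Lap G) P → ∀ y u → (P ⋆ (Lap G ⋆ y)) u ≡ centred y u
minNormGInverse-Lap {n} G conn v {P} (LPL≡L , PL-sym) y u = begin
  q u                              ≡⟨ q≡y+β u ⟩
  y u + β                          ≡⟨ cong (y u +_) (S+N*β≡0⇒β≡-I*S {N = sumF {n} (λ _ → 1ℚ)} (sumF-1*invℕ v) ones·y+Nβ≡0) ⟩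
  y u + - (invℕ n * (ones · y))    ∎
  where
  q : Vect n
  q = P ⋆ (Lap G ⋆ y)
  β : ℚ
  β = q v - y v
  Lap-⋆-q : ∀ u → (Lap G ⋆ q) u ≡ (Lap G ⋆ y) u
  Lap-⋆-q u = begin
    (Lap G ⋆ (P ⋆ (Lap G ⋆ y))) u     ≡⟨ ⊗-⋆ (Lap G) P (Lap G ⋆ y) u ⟨
    ((Lap G ⊗ P) ⋆ (Lap G ⋆ y)) u     ≡⟨ ⊗-⋆ (Lap G ⊗ P) (Lap G) y u ⟨
    (((Lap G ⊗ P) ⊗ Lap G) ⋆ y) u     ≡⟨ ⋆-congˡ y LPL≡L u ⟩
    (Lap G ⋆ y) u                     ∎
  q≡y+β : ∀ u → q u ≡ y u + β
  q≡y+β u = trans (sym (rearrange (q u) (y u))) (cong (y u +_) (Lap-kernel-constant G conn Lap-⋆-q-y u v))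
    where
    Lap-⋆-q-y : ∀ u → (Lap G ⋆ (q ⊖ y)) u ≡ 0ℚ
    Lap-⋆-q-y u = trans (⋆-distrib-⊖ (Lap G) q y u)
                        (trans (cong (_- (Lap G ⋆ y) u) (Lap-⋆-q u)) (ℚ.+-inverseʳ ((Lap G ⋆ y) u)))
    rearrange : ∀ a b → b + (a - b) ≡ a
    rearrange = solve-∀ ℚ-ring
  PLᵀ-ones≡0 : ∀ k → (transpose (P ⊗ Lap G) ⋆ ones) k ≡ 0ℚ
  PLᵀ-ones≡0 k = begin
    (transpose (P ⊗ Lap G) ⋆ ones) k   ≡⟨ ⋆-congˡ {M = transpose (P ⊗ Lap G)} ones (λ a b → PL-sym b a) k ⟩
    ((P ⊗ Lap G) ⋆ ones) k             ≡⟨ ⊗-⋆ P (Lap G) ones k ⟩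
    (P ⋆ (Lap G ⋆ ones)) k             ≡⟨ sumF-zero (λ m → trans (cong (P k m *_) (Lap-⋆-ones G m)) (ℚ.*-zeroʳ (P k m))) ⟩
    0ℚ                                 ∎
  ones·y+Nβ≡0 : ones · y + sumF {n} (λ _ → 1ℚ) * β ≡ 0ℚ
  ones·y+Nβ≡0 = begin
    ones · y + sumF {n} (λ _ → 1ℚ) * β      ≡⟨ cong (ones · y +_) (*-distribʳ-sumF {n} β (λ _ → 1ℚ)) ⟩
    ones · y + sumF {n} (λ _ → 1ℚ * β)      ≡⟨ sumF-distrib-+ (λ u → 1ℚ * y u) (λ _ → 1ℚ * β) ⟨
    sumF (λ u → 1ℚ * y u + 1ℚ * β)          ≡⟨ sumF-cong (λ u → trans (cong (1ℚ *_) (q≡y+β u)) (ℚ.*-distribˡ-+ 1ℚ (y u) β)) ⟨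
    ones · q                                ≡⟨ sumF-cong (λ u → cong (1ℚ *_) (⊗-⋆ P (Lap G) y u)) ⟨
    ones · ((P ⊗ Lap G) ⋆ y)                ≡⟨ ·-⋆ ones (P ⊗ Lap G) y ⟩
    (transpose (P ⊗ Lap G) ⋆ ones) · y      ≡⟨ sumF-zero (λ k → trans (cong (_* y k) (PLᵀ-ones≡0 k)) (ℚ.*-zeroˡ (y k))) ⟩
    0ℚ                                      ∎

bST-via-Laplacian-preimage : ∀ {n} (G : SimpleGraph n) → Connected G → ∀ {P s t y} →
  IsPseudoInverse (Lap G) P → (∀ u → (Lap G ⋆ y) u ≡ (e s ⊖ e t) u) →
  bST P s t ≡ y · y - invℕ n * ((ones · y) * (ones · y))
bST-via-Laplacian-preimage {n} G conn {P} {s} {t} {y} P⁺ Ly≡x = begin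
  x · ((P ⊗ P) ⋆ x)                 ≡⟨ sumF-cong (λ u → cong (x u *_) (⊗-⋆ P P x u)) ⟩
  x · (P ⋆ (P ⋆ x))                 ≡⟨ ·-⋆ x P (P ⋆ x) ⟩
  (transpose P ⋆ x) · (P ⋆ x)       ≡⟨ sumF-cong (λ u → cong₂ _*_ (centres Pᵀ-gInverse u) (centres P-gInverse u)) ⟩
  centred y · centred y             ≡⟨ centred-·-centred s y ⟩
  y · y - invℕ n * ((ones · y) * (ones · y)) ∎
  where
  x : Vect n
  x = e s ⊖ e t
  P-gInverse : IsMinNormGInverse (Lap G) P
  P-gInverse = pseudoInverse⇒minNormGInverse P⁺
  Pᵀ-gInverse : IsMinNormGInverse (Lap G) (transpose P)
  Pᵀ-gInverse = pseudoInverse⇒transpose-minNormGInverse (Lap-sym G) P⁺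
  centres : ∀ {Q} → IsMinNormGInverse (Lap G) Q → ∀ u → (Q ⋆ x) u ≡ centred y u
  centres {Q} Q-gInverse u = trans (⋆-congʳ Q (sym ∘ Ly≡x) u) (minNormGInverse-Lap G conn s Q-gInverse y u)

-- The sets R⁽ⁱ⁾

∧≡true⇔ : ∀ {a b : Bool} → (a ∧ b) ≡ true ⇔ (a ≡ true × b ≡ true)
∧≡true⇔ = mk⇔ (λ h → ∧-conicalˡ _ _ h , ∧-conicalʳ _ _ h) (λ (a≡true , b≡true) → cong₂ _∧_ a≡true b≡true)

allF≡true⇔ : ∀ {m} {f : Fin m → Bool} → allF f ≡ true ⇔ (∀ k → f k ≡ true)
allF≡true⇔ = mk⇔ to from
  where
  to : ∀ {m} {f : Fin m → Bool} → allF f ≡ true → ∀ k → f k ≡ true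
  to h zero    = ∧-conicalˡ _ _ h
  to h (suc k) = to (∧-conicalʳ _ _ h) k
  from : ∀ {m} {f : Fin m → Bool} → (∀ k → f k ≡ true) → allF f ≡ true
  from {zero}  _ = refl
  from {suc m} h = cong₂ _∧_ (h zero) (from (h ∘ suc))

not-==≡true⇔ : ∀ {n} {u w : Fin n} → not (u == w) ≡ true ⇔ u ≢ w
not-==≡true⇔ = mk⇔ (λ h u≡w → true≢false (trans (sym h) (cong not (≡⇒== u≡w)))) (cong not ∘ ≢⇒==)

not-∧≡true⇔ : ∀ {p q : Bool} → not (p ∧ q) ≡ true ⇔ (p ≡ true → q ≡ false)
not-∧≡true⇔ {true}  {q} = mk⇔ (λ h _ → not-injective h) (λ h → cong not (h refl))
not-∧≡true⇔ {false}     = mk⇔ (λ _ ()) (λ _ → refl)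

module _ {n j} (v : Fin n) (c : Fin j → Fin n) where

  Remaining : ℕ → Fin n → Set
  Remaining i u = u ≢ v × (∀ k → toℕ k ℕ.< i → u ≢ c k)

  R≡true⇔Remaining : ∀ i u → R v c i u ≡ true ⇔ Remaining i u
  R≡true⇔Remaining i u = mk⇔ to from
    where
    to : R v c i u ≡ true → Remaining i u
    to h with u≢vᵇ , none-removedᵇ ← Equivalence.to ∧≡true⇔ h =
      Equivalence.to not-==≡true⇔ u≢vᵇ , not-removed
      where
      not-removed : ∀ k → toℕ k ℕ.< i → u ≢ c k
      not-removed k k<i u≡ck = true≢false (trans (sym (≡⇒== u≡ck))
        (Equivalence.to not-∧≡true⇔ (Equivalence.to allF≡true⇔ none-removedᵇ k) (Equivalence.to T-≡ (<⇒<ᵇ k<i))))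
    from : Remaining i u → R v c i u ≡ true
    from (u≢v , not-removed) = cong₂ _∧_ (Equivalence.from not-==≡true⇔ u≢v)
      (Equivalence.from allF≡true⇔ λ k → Equivalence.from not-∧≡true⇔ λ k<ᵇi →
        ≢⇒== (not-removed k (<ᵇ⇒< (toℕ k) i (Equivalence.from T-≡ k<ᵇi))))

  R-suc : ∀ k u → R v c (suc (toℕ k)) u ≡ (R v c (toℕ k) u ∧ not (u == c k))
  R-suc k u = ⇔→≡ (mk⇔ to from)
    where
    to : R v c (suc (toℕ k)) u ≡ true → (R v c (toℕ k) u ∧ not (u == c k)) ≡ true
    to h with u≢v , not-removed ← Equivalence.to (R≡true⇔Remaining (suc (toℕ k)) u) h =
      cong₂ _∧_ (Equivalence.from (R≡true⇔Remaining (toℕ k) u) (u≢v , λ k′ k′<k → not-removed k′ (m<n⇒m<1+n k′<k)))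
                (Equivalence.from not-==≡true⇔ (not-removed k (n<1+n (toℕ k))))
    from : (R v c (toℕ k) u ∧ not (u == c k)) ≡ true → R v c (suc (toℕ k)) u ≡ true
    from h with u≢v , not-removed ← Equivalence.to (R≡true⇔Remaining (toℕ k) u) (proj₁ (Equivalence.to ∧≡true⇔ h)) =
      Equivalence.from (R≡true⇔Remaining (suc (toℕ k)) u) (u≢v , not-removed′)
      where
      u≢ck : u ≢ c k
      u≢ck = Equivalence.to not-==≡true⇔ (proj₂ (Equivalence.to ∧≡true⇔ h))
      not-removed′ : ∀ k′ → toℕ k′ ℕ.< suc (toℕ k) → u ≢ c k′
      not-removed′ k′ k′≤k with m<1+n⇒m<n∨m≡n k′≤k
      ... | inj₁ k′<k = not-removed k′ k′<k
      ... | inj₂ k′≡k = subst (λ k″ → u ≢ c k″) (sym (toℕ-injective k′≡k)) u≢ck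

  R-c : Injective _≡_ _≡_ c → (∀ k → c k ≢ v) → ∀ k → R v c (toℕ k) (c k) ≡ true
  R-c c-injective c≢v k = Equivalence.from (R≡true⇔Remaining (toℕ k) (c k))
    (c≢v k , λ k′ k′<k ck≡ck′ → <-irrefl (cong toℕ (sym (c-injective ck≡ck′))) k′<k)

  R-zero : ∀ u → u ≢ v → R v c 0 u ≡ true
  R-zero u u≢v = Equivalence.from (R≡true⇔Remaining 0 u) (u≢v , λ _ ())

lemma3p4 : ∀ {n j : ℕ} (G : SimpleGraph n) → Connected G →
    (v : Fin n) (c : Fin j → Fin n) →
    Injective _≡_ _≡_ c → (∀ k → ¬ (c k ≡ v)) →
    (Vs Vt : Subset n) →
    (∀ u → R v c j u ≡ (Vs u ∨ Vt u)) →
    (∀ u → (Vs u ∧ Vt u) ≡ false) →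
    (∀ u w → Vs u ≡ true → Vt w ≡ true → adj G u w ≡ false) →
    (s t : Fin n) → Vs s ≡ true → Vt t ≡ true →
    (P : Mat n) → IsPseudoInverse (Lap G) P →
    (Xs Xt : Mat n) → IsPaddedInverse (Lap G) Vs Xs → IsPaddedInverse (Lap G) Vt Xt →
    (Y : Fin j → Mat n) → (∀ k → IsPaddedInverse (Lap G) (R v c (suc (toℕ k))) (Y k)) →
    (σ : Fin j → ℚ) →
    (∀ k → σ k * schur G (R v c (suc (toℕ k))) (Y k) (c k) ≡ 1ℚ) →
    let y = ((Xs ⋆ e s) ⊖ (Xt ⋆ e t)) ⊕
            sumFin (λ k → Mtilde G (R v c (suc (toℕ k))) (Y k) (c k) (σ k) ⋆ (e s ⊖ e t))
    in bST P s t ≡ (y · y) - (invℕ n * ((ones · y) * (ones · y)))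
lemma3p4 G conn v c c-injective c≢v Vs Vt R≡Vs∨Vt _ Vs↮Vt s t Vs-s Vt-t P P⁺ Xs Xt Xs⁻¹ Xt⁻¹ Y Y⁻¹ σ σ-inverse =
  bST-via-Laplacian-preimage G conn P⁺ (paddedSolution-extends G v (R-zero v c) Σx≡0 y-solves)
  where
  bordering : ∀ k → Bordering G (R v c (toℕ k)) (R v c (suc (toℕ k))) (c k) (Y k) (σ k)
  bordering k = record
    { S₁≡S₀-c   = R-suc v c k
    ; c∈S₀      = R-c v c c-injective c≢v k
    ; Y-inverse = Y⁻¹ k
    ; σ-inverse = σ-inverse k
    }
  y-solves : IsPaddedSolution (Lap G) (R v c 0) (e s ⊖ e t)
               (((Xs ⋆ e s) ⊖ (Xt ⋆ e t)) ⊕ sumFin (λ k → Mtilde G (R v c (suc (toℕ k))) (Y k) (c k) (σ k) ⋆ (e s ⊖ e t)))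
  y-solves = paddedSolution-bordering-chain (R v c) c Y σ bordering
    (paddedSolution-two-components G R≡Vs∨Vt Vs↮Vt Vs-s Vt-t Xs⁻¹ Xt⁻¹)
  Σx≡0 : sumF (e s ⊖ e t) ≡ 0ℚ
  Σx≡0 = trans (sumF-distrib-- (e s) (e t)) (cong₂ _-_ (sumF-e s) (sumF-e t))
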